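{- Let $\Pi$ be an STR derivation of $\Gamma\vdash M:\sigma$. Then (i) $rk(\Pi)\le |M|$; (ii) $W(\Pi,r)\le r^{D(\Pi)}\cdot W(\Pi,1)$ for every positive $r$; (iii) $W(\Pi,1)=|M|$.
   Context: Terms: $M ::= x \mid \lambda x.M \mid MM$ modulo $\alpha$-equivalence; $FV(M)$ free variables. Size: $|x|=1$, $|\lambda x.M|=|M|+1$, $|MN|=|M|+|N|+1$. STR types: linear $A ::= a \mid \sigma\multimap A \mid \forall a.A$, stratified $\sigma ::= A \mid \{\sigma_1,\dots,\sigma_n\}$ ($n\ge1$), modulo renaming of bound type variables and the congruence treating $\{\sigma_1,\dots,\sigma_n\}$ as a finite set. Contexts are finite partial maps from term variables to types. Rules ($A,B$ linear): (Ax) $x:A\vdash x:A$; (w) from $\Gamma\vdash M:\sigma$, $x\notin dom(\Gamma)$, infer $\Gamma,x:A\vdash M:\sigma$; ($\multimap$I) from $\Gamma,x:\sigma\vdash M:B$ infer $\Gamma\vdash\lambda x.M:\sigma\multimap B$; ($\multimap$E) from $\Gamma_1\vdash M:\sigma\multimap A$, $\Gamma_2\vdash N:\sigma$ with disjoint domains infer $\Gamma_1,\Gamma_2\vdash MN:A$; (m) from $\Gamma,x_1:\sigma_1,\dots,x_n:\sigma_n\vdash M:\tau$ infer $\Gamma,x:\{\sigma_1,\dots,\sigma_n\}\vdash M[x/x_1,\dots,x/x_n]:\tau$ (domain $\{x_1,\dots,x_n\}$); (st) from $\Gamma_i\vdash M:\sigma_i$ ($1\le i\le n$), all $\Gamma_i$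 with the same domain, infer $\bigcup_i\{\Gamma_i\}\vdash M:\{\sigma_1,\dots,\sigma_n\}$, where $(\bigcup_i\{\Gamma_i\})(x)=\{\Gamma_1(x),\dots,\Gamma_n(x)\}$; ($\forall$I) from $\Gamma\vdash M:A$, $a$ not free in $\Gamma$, infer $\Gamma\vdash M:\forall a.A$; ($\forall$E) from $\Gamma\vdash M:\forall a.B$ infer $\Gamma\vdash M:B[A/a]$, $A$ linear. Rank: the rank of an application of (m) with domain $X$ and premise subject $M$ is $|X\cap FV(M)|$; $rk(\Pi)=\max\{1,r\}$ with $r$ the maximal rank of (m) applications in $\Pi$. Degree $D(\Pi)$: maximal number of (st) applications on a path from the conclusion to an axiom. Weight $W(\Pi,r)$ for $r>0$: $1$ for an axiom; $W(\Pi',r)+1$ for ($\multimap$I) with premise $\Pi'$; $W(\Pi_1,r)+W(\Pi_2,r)+1$ for ($\multimap$E); $r\cdot\max_i W(\Pi_i,r)$ for (st) with premises $\Pi_1,\dots,\Pi_n$; $W(\Pi',r)$ for (w), (m), ($\forall$I), ($\forall$E) with premise $\Pi'$. -}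

module Defs where

open import Data.Nat using (ℕ; zero; suc; _+_; _*_; _⊔_; _<_; _≡ᵇ_)
open import Data.Nat.Properties using (_≟_)
open import Data.Bool using (Bool; true; false; if_then_else_; _∨_)
open import Data.Fin using (Fin) renaming (zero to fzero; suc to fsuc)
open import Data.List using (List; []; _∷_; _++_; map; length; filter; deduplicate; tabulate)
open import Data.List.Relation.Unary.All using (All)
open import Data.List.Relation.Unary.Any using (Any)
open import Data.List.Relation.Unary.Unique.Propositional using (Unique)
open import Data.List.Membership.Propositional using (_∈_; _∉_)
open import Data.List.Membership.DecPropositional _≟_ using (_∈?_)
open import Data.Product using (Σ; _×_; _,_; proj₁)
open import Data.Empty using (⊥)
open import Data.Unit using (⊤)
open import Function using (_∘_)
open import Relation.Nullary.Decidable using (does)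
open import Relation.Binary.PropositionalEquality using (_≡_)

-- Terms, locally nameless: free variables are named (ℕ), bound
-- variables are de Bruijn indices.  Locally closed raw terms are in
-- bijection with λ-terms modulo α-equivalence.

data Tm : Set where
  fvar : ℕ → Tm
  bvar : ℕ → Tm
  lam  : Tm → Tm
  app  : Tm → Tm → Tm

closeAt : ℕ → ℕ → Tm → Tm
closeAt k x (fvar y)  = if x ≡ᵇ y then bvar k else fvar y
closeAt k x (bvar i)  = bvar i
closeAt k x (lam M)   = lam (closeAt (suc k) x M)
closeAt k x (app M N) = app (closeAt k x M) (closeAt k x N)

ƛ : ℕ → Tm → Tm
ƛ x M = lam (closeAt 0 x M)

size : Tm → ℕ
size (fvar _)  = 1
size (bvar _)  = 1
size (lam M)   = size M + 1
size (app M N) = size M + size N + 1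

fv : Tm → List ℕ
fv (fvar x)  = x ∷ []
fv (bvar _)  = []
fv (lam M)   = fv M
fv (app M N) = fv M ++ fv N

renameTo : ℕ → List ℕ → Tm → Tm
renameTo x X (fvar y)  = if does (y ∈? X) then fvar x else fvar y
renameTo x X (bvar i)  = bvar i
renameTo x X (lam M)   = lam (renameTo x X M)
renameTo x X (app M N) = app (renameTo x X M) (renameTo x X N)

interSize : List ℕ → Tm → ℕ
interSize X M = length (filter (_∈? X) (deduplicate _≟_ (fv M)))

-- STR types, locally nameless for type variables (so renaming of bound
-- type variables is built in).  Linear types Lin, stratified types Str.
-- set σ σs  stands for  {σ, σs...}  (n ≥ 1).

mutual
  data Lin : Set where
    tvar : ℕ → Lin
    tbv  : ℕ → Lin
    _⊸_  : Str → Lin → Lin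
    all  : Lin → Lin

  data Str : Set where
    lin : Lin → Str
    set : Str → List Str → Str

-- The congruence: {σ1..σn} is a finite set (mutual inclusion up to ≈).
mutual
  data _≈L_ : Lin → Lin → Set where
    tvar≈ : ∀ {a} → tvar a ≈L tvar a
    tbv≈  : ∀ {i} → tbv i ≈L tbv i
    ⊸≈    : ∀ {σ σ' A A'} → σ ≈S σ' → A ≈L A' → (σ ⊸ A) ≈L (σ' ⊸ A')
    all≈  : ∀ {A A'} → A ≈L A' → all A ≈L all A'

  data _≈S_ : Str → Str → Set where
    lin≈ : ∀ {A B} → A ≈L B → lin A ≈S lin B
    set≈ : ∀ {σ σs τ τs} →
           All (λ ρ → Any (ρ ≈S_) (τ ∷ τs)) (σ ∷ σs) →
           All (λ ρ → Any (_≈S ρ) (σ ∷ σs)) (τ ∷ τs) →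
           set σ σs ≈S set τ τs

mutual
  lcL : ℕ → Lin → Set
  lcL k (tvar _) = ⊤
  lcL k (tbv i)  = i < k
  lcL k (σ ⊸ A)  = lcS k σ × lcL k A
  lcL k (all A)  = lcL (suc k) A

  lcS : ℕ → Str → Set
  lcS k (lin A)    = lcL k A
  lcS k (set σ σs) = lcS k σ × lcSs k σs

  lcSs : ℕ → List Str → Set
  lcSs k []       = ⊤
  lcSs k (σ ∷ σs) = lcS k σ × lcSs k σs

mutual
  occL : ℕ → Lin → Bool
  occL a (tvar b) = a ≡ᵇ b
  occL a (tbv _)  = false
  occL a (σ ⊸ A)  = occS a σ ∨ occL a A
  occL a (all A)  = occL a A

  occS : ℕ → Str → Bool
  occS a (lin A)    = occL a A
  occS a (set σ σs) = occS a σ ∨ occSs a σs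

  occSs : ℕ → List Str → Bool
  occSs a []       = false
  occSs a (σ ∷ σs) = occS a σ ∨ occSs a σs

mutual
  openL : ℕ → Lin → Lin → Lin
  openL k A (tvar b) = tvar b
  openL k A (tbv i)  = if i ≡ᵇ k then A else tbv i
  openL k A (σ ⊸ B)  = openS k A σ ⊸ openL k A B
  openL k A (all B)  = all (openL (suc k) A B)

  openS : ℕ → Lin → Str → Str
  openS k A (lin B)    = lin (openL k A B)
  openS k A (set σ σs) = set (openS k A σ) (openSs k A σs)

  openSs : ℕ → Lin → List Str → List Str
  openSs k A []       = []
  openSs k A (σ ∷ σs) = openS k A σ ∷ openSs k A σs

mutual
  closeL : ℕ → ℕ → Lin → Lin
  closeL k a (tvar b) = if a ≡ᵇ b then tbv k else tvar b
  closeL k a (tbv i)  = tbv i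
  closeL k a (σ ⊸ B)  = closeS k a σ ⊸ closeL k a B
  closeL k a (all B)  = all (closeL (suc k) a B)

  closeS : ℕ → ℕ → Str → Str
  closeS k a (lin B)    = lin (closeL k a B)
  closeS k a (set σ σs) = set (closeS k a σ) (closeSs k a σs)

  closeSs : ℕ → ℕ → List Str → List Str
  closeSs k a []       = []
  closeSs k a (σ ∷ σs) = closeS k a σ ∷ closeSs k a σs

∀[_]_ : ℕ → Lin → Lin
∀[ a ] A = all (closeL 0 a A)

setOf : ∀ {n} → (Fin (suc n) → Str) → Str
setOf σs = set (σs fzero) (tabulate (σs ∘ fsuc))

-- Contexts: finite partial maps, represented as lists of bindings with
-- pairwise distinct variables (WF).  Order is irrelevant thanks to the
-- conversion rule below, which identifies contexts denoting the same map.

Ctx : Set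
Ctx = List (ℕ × Str)

dom : Ctx → List ℕ
dom = map proj₁

WF : Ctx → Set
WF Γ = Unique (dom Γ)

_∋_∶_ : Ctx → ℕ → Str → Set
Γ ∋ x ∶ σ = (x , σ) ∈ Γ

Disjoint : Ctx → Ctx → Set
Disjoint Γ Δ = ∀ x → x ∈ dom Γ → x ∈ dom Δ → ⊥

_≈C_ : Ctx → Ctx → Set
Γ ≈C Δ = WF Δ
       × (∀ x σ → Γ ∋ x ∶ σ → Σ Str λ τ → Δ ∋ x ∶ τ × σ ≈S τ)
       × (∀ x τ → Δ ∋ x ∶ τ → Σ Str λ σ → Γ ∋ x ∶ σ × σ ≈S τ)

-- Δ = ⋃_i {Γ_i}, all Γ_i having the same domain (that of Δ)
IsUnion : ∀ {n} → (Fin (suc n) → Ctx) → Ctx → Set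
IsUnion {n} Γs Δ =
    WF Δ
  × (∀ i x → (x ∈ dom (Γs i) → x ∈ dom Δ) × (x ∈ dom Δ → x ∈ dom (Γs i)))
  × (∀ x τ → Δ ∋ x ∶ τ →
       Σ (Fin (suc n) → Str) λ ρ → (∀ i → Γs i ∋ x ∶ ρ i) × τ ≡ setOf ρ)

bindings : ∀ {n} → (Fin (suc n) → ℕ) → (Fin (suc n) → Str) → Ctx
bindings xs σs = tabulate (λ i → xs i , σs i)

varList : ∀ {n} → (Fin (suc n) → ℕ) → List ℕ
varList xs = tabulate xs

-- STR derivations.  `conv` is not a rule of the paper: it only expresses
-- that judgements are taken modulo the congruence on types and that
-- contexts are partial maps (list order irrelevant); all measures ignore it.

infix 3 _⊢_∶_
data _⊢_∶_ : Ctx → Tm → Str → Set where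
  ax   : ∀ {x A} → lcL 0 A → ((x , lin A) ∷ []) ⊢ fvar x ∶ lin A
  w    : ∀ {Γ M σ x A} → lcL 0 A → x ∉ dom Γ →
         Γ ⊢ M ∶ σ → ((x , lin A) ∷ Γ) ⊢ M ∶ σ
  ⊸I   : ∀ {Γ x σ M B} →
         ((x , σ) ∷ Γ) ⊢ M ∶ lin B → Γ ⊢ ƛ x M ∶ lin (σ ⊸ B)
  ⊸E   : ∀ {Γ₁ Γ₂ M N σ A} → Disjoint Γ₁ Γ₂ →
         Γ₁ ⊢ M ∶ lin (σ ⊸ A) → Γ₂ ⊢ N ∶ σ → (Γ₁ ++ Γ₂) ⊢ app M N ∶ lin A
  m    : ∀ {n Γ M τ x} (xs : Fin (suc n) → ℕ) (σs : Fin (suc n) → Str) →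
         x ∉ dom Γ →
         (Γ ++ bindings xs σs) ⊢ M ∶ τ →
         ((x , setOf σs) ∷ Γ) ⊢ renameTo x (varList xs) M ∶ τ
  st   : ∀ {n M Δ} (Γs : Fin (suc n) → Ctx) (σs : Fin (suc n) → Str) →
         IsUnion Γs Δ →
         ((i : Fin (suc n)) → Γs i ⊢ M ∶ σs i) →
         Δ ⊢ M ∶ setOf σs
  ∀I   : ∀ {Γ M A a} → (∀ y σ → Γ ∋ y ∶ σ → occS a σ ≡ false) →
         Γ ⊢ M ∶ lin A → Γ ⊢ M ∶ lin (∀[ a ] A)
  ∀E   : ∀ {Γ M B} (A : Lin) → lcL 0 A →
         Γ ⊢ M ∶ lin (all B) → Γ ⊢ M ∶ lin (openL 0 A B)
  conv : ∀ {Γ Δ M σ τ} → Γ ≈C Δ → σ ≈S τ → Γ ⊢ M ∶ σ → Δ ⊢ M ∶ τ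

maxF : ∀ {n} → (Fin n → ℕ) → ℕ
maxF {zero}  f = 0
maxF {suc n} f = f fzero ⊔ maxF (f ∘ fsuc)

maxRank : ∀ {Γ M σ} → Γ ⊢ M ∶ σ → ℕ
maxRank (ax _)          = 0
maxRank (w _ _ d)       = maxRank d
maxRank (⊸I d)          = maxRank d
maxRank (⊸E _ d e)      = maxRank d ⊔ maxRank e
maxRank (m {M = M} xs σs _ d) = interSize (varList xs) M ⊔ maxRank d
maxRank (st Γs σs _ ds) = maxF (λ i → maxRank (ds i))
maxRank (∀I _ d)        = maxRank d
maxRank (∀E A _ d)      = maxRank d
maxRank (conv _ _ d)    = maxRank d

rk : ∀ {Γ M σ} → Γ ⊢ M ∶ σ → ℕ
rk d = 1 ⊔ maxRank d

D : ∀ {Γ M σ} → Γ ⊢ M ∶ σ → ℕ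
D (ax _)          = 0
D (w _ _ d)       = D d
D (⊸I d)          = D d
D (⊸E _ d e)      = D d ⊔ D e
D (m xs σs _ d)   = D d
D (st Γs σs _ ds) = suc (maxF (λ i → D (ds i)))
D (∀I _ d)        = D d
D (∀E A _ d)      = D d
D (conv _ _ d)    = D d

W : ∀ {Γ M σ} → Γ ⊢ M ∶ σ → ℕ → ℕ
W (ax _)          r = 1
W (w _ _ d)       r = W d r
W (⊸I d)          r = W d r + 1
W (⊸E _ d e)      r = W d r + W e r + 1
W (m xs σs _ d)   r = W d r
W (st Γs σs _ ds) r = r * maxF (λ i → W (ds i) r)
W (∀I _ d)        r = W d r
W (∀E A _ d)      r = W d r
W (conv _ _ d)    r = W d r

module Submission where

-- All three parts are proved by structural induction on Π, using only that
-- the subject of a premise is never larger than the subject of the conclusion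
-- and that the rules (m) and (⊸I) change the subject only by renaming or
-- closing a variable, which preserves size.

open import Defs
open import Data.Nat using (ℕ; zero; suc; _+_; _*_; _^_; _⊔_; _≤_; _<_; z≤n; NonZero; >-nonZero; _≡ᵇ_)
open import Data.Nat.Properties
open import Data.Product using (_×_; _,_)
open import Data.Fin using (Fin) renaming (zero to fzero; suc to fsuc)
open import Data.Bool using (true; false)
open import Data.List using (length; filter; deduplicate)
open import Data.List.Properties using (length-++; length-filter; length-deduplicate)
open import Data.List.Membership.DecPropositional _≟_ using (_∈?_)
open import Relation.Nullary.Decidable using (does)
open import Relation.Binary.PropositionalEquality using (_≡_; refl; sym; trans; cong; cong₂; subst)
open import Function using (_∘_)

size-closeAt : ∀ k x M → size (closeAt k x M) ≡ size M
size-closeAt k x (fvar y) with x ≡ᵇ y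
... | true  = refl
... | false = refl
size-closeAt k x (bvar i)  = refl
size-closeAt k x (lam M)   = cong (_+ 1) (size-closeAt (suc k) x M)
size-closeAt k x (app M N) =
  cong₂ (λ a b → a + b + 1) (size-closeAt k x M) (size-closeAt k x N)

size-ƛ : ∀ x M → size (ƛ x M) ≡ size M + 1
size-ƛ x M = cong (_+ 1) (size-closeAt 0 x M)

size-renameTo : ∀ x X M → size (renameTo x X M) ≡ size M
size-renameTo x X (fvar y) with does (y ∈? X)
... | true  = refl
... | false = refl
size-renameTo x X (bvar i)  = refl
size-renameTo x X (lam M)   = cong (_+ 1) (size-renameTo x X M)
size-renameTo x X (app M N) =
  cong₂ (λ a b → a + b + 1) (size-renameTo x X M) (size-renameTo x X N)

-- Every term has size at least 1 (this gives rk Π ≤ |M| when rk Π = 1).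
size-positive : ∀ M → 1 ≤ size M
size-positive (fvar x)  = ≤-refl
size-positive (bvar i)  = ≤-refl
size-positive (lam M)   = m≤n+m 1 (size M)
size-positive (app M N) = m≤n+m 1 (size M + size N)

size-app-left : ∀ M N → size M ≤ size (app M N)
size-app-left M N = ≤-trans (m≤m+n (size M) (size N)) (m≤m+n _ 1)

size-app-right : ∀ M N → size N ≤ size (app M N)
size-app-right M N = ≤-trans (m≤n+m (size N) (size M)) (m≤m+n _ 1)

-- Free variable occurrences are among the leaves of a term.
length-fv≤size : ∀ M → length (fv M) ≤ size M
length-fv≤size (fvar x)  = ≤-refl
length-fv≤size (bvar i)  = z≤n
length-fv≤size (lam M)   = ≤-trans (length-fv≤size M) (m≤m+n (size M) 1)
length-fv≤size (app M N) rewrite length-++ (fv M) {fv N} =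
  ≤-trans (+-mono-≤ (length-fv≤size M) (length-fv≤size N)) (m≤m+n _ 1)

interSize≤size : ∀ X M → interSize X M ≤ size M
interSize≤size X M = begin
  length (filter (_∈? X) (deduplicate _≟_ (fv M))) ≤⟨ length-filter (_∈? X) (deduplicate _≟_ (fv M)) ⟩
  length (deduplicate _≟_ (fv M))                  ≤⟨ length-deduplicate _≟_ (fv M) ⟩
  length (fv M)                                    ≤⟨ length-fv≤size M ⟩
  size M                                           ∎
  where open ≤-Reasoning

maxF-lub : ∀ {n} (f : Fin n → ℕ) {c} → (∀ i → f i ≤ c) → maxF f ≤ c
maxF-lub {zero}  f h = z≤n
maxF-lub {suc n} f h = ⊔-lub (h fzero) (maxF-lub (f ∘ fsuc) (h ∘ fsuc))

maxF-ub : ∀ {n} (f : Fin n → ℕ) i → f i ≤ maxF f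
maxF-ub f fzero    = m≤m⊔n _ _
maxF-ub f (fsuc i) = ≤-trans (maxF-ub (f ∘ fsuc) i) (m≤n⊔m _ _)

maxF-const : ∀ {n} (f : Fin (suc n) → ℕ) {c} → (∀ i → f i ≡ c) → maxF f ≡ c
maxF-const f h = ≤-antisym (maxF-lub f (≤-reflexive ∘ h))
                           (subst (_≤ maxF f) (h fzero) (maxF-ub f fzero))

weight-one : ∀ {Γ M σ} (Π : Γ ⊢ M ∶ σ) → W Π 1 ≡ size M
weight-one (ax _)                    = refl
weight-one (w _ _ Π)                 = weight-one Π
weight-one (⊸I {x = x} {M = M} Π)    = trans (cong (_+ 1) (weight-one Π)) (sym (size-ƛ x M))
weight-one (⊸E _ Π Π′)               = cong₂ (λ a b → a + b + 1) (weight-one Π) (weight-one Π′)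
weight-one (m {M = M} {x = x} xs _ _ Π) =
  trans (weight-one Π) (sym (size-renameTo x (varList xs) M))
weight-one (st {M = M} _ _ _ Πs)     =
  trans (*-identityˡ _) (maxF-const (λ i → W (Πs i) 1) (λ i → weight-one (Πs i)))
weight-one (∀I _ Π)                  = weight-one Π
weight-one (∀E _ _ Π)                = weight-one Π
weight-one (conv _ _ Π)              = weight-one Π

maxRank≤size : ∀ {Γ M σ} (Π : Γ ⊢ M ∶ σ) → maxRank Π ≤ size M
maxRank≤size (ax _)                  = z≤n
maxRank≤size (w _ _ Π)               = maxRank≤size Π
maxRank≤size (⊸I {x = x} {M = M} Π)  =
  ≤-trans (maxRank≤size Π) (≤-trans (m≤m+n (size M) 1) (≤-reflexive (sym (size-ƛ x M))))
maxRank≤size (⊸E {M = M} {N = N} _ Π Π′) =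
  ⊔-lub (≤-trans (maxRank≤size Π) (size-app-left M N))
        (≤-trans (maxRank≤size Π′) (size-app-right M N))
maxRank≤size (m {M = M} {x = x} xs _ _ Π) =
  subst (_ ≤_) (sym (size-renameTo x (varList xs) M))
        (⊔-lub (interSize≤size (varList xs) M) (maxRank≤size Π))
maxRank≤size (st _ _ _ Πs)           = maxF-lub _ (λ i → maxRank≤size (Πs i))
maxRank≤size (∀I _ Π)                = maxRank≤size Π
maxRank≤size (∀E _ _ Π)              = maxRank≤size Π
maxRank≤size (conv _ _ Π)            = maxRank≤size Π

scaled-suc : ∀ {p a s} → 1 ≤ p → a ≤ p * s → a + 1 ≤ p * (s + 1)
scaled-suc {p} {a} {s} 1≤p a≤ps = begin
  a + 1         ≤⟨ +-mono-≤ a≤ps (≤-trans 1≤p (≤-reflexive (sym (*-identityʳ p)))) ⟩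
  p * s + p * 1 ≡⟨ sym (*-distribˡ-+ p s 1) ⟩
  p * (s + 1)   ∎
  where open ≤-Reasoning

scaled-+ : ∀ p {a b s t} → a ≤ p * s → b ≤ p * t → a + b ≤ p * (s + t)
scaled-+ p {s = s} {t = t} a≤ps b≤pt =
  ≤-trans (+-mono-≤ a≤ps b≤pt) (≤-reflexive (sym (*-distribˡ-+ p s t)))

-- Part (ii), with |M| in place of W(Π,1).
module WeightBound (r : ℕ) .{{_ : NonZero r}} where

  raise-degree : ∀ {a d e s} → d ≤ e → a ≤ r ^ d * s → a ≤ r ^ e * s
  raise-degree {s = s} d≤e a≤ = ≤-trans a≤ (*-monoˡ-≤ s (^-monoʳ-≤ r d≤e))

  -- W(Π,r) ≤ r^D(Π)·|M|: each (st) multiplies by r, every other rule adds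
  -- at most as much weight as it adds size, scaled by r^D(Π) ≥ 1.
  weight≤ : ∀ {Γ M σ} (Π : Γ ⊢ M ∶ σ) → W Π r ≤ r ^ D Π * size M
  weight≤ (ax _)                 = ≤-reflexive (sym (*-identityʳ 1))
  weight≤ (w _ _ Π)              = weight≤ Π
  weight≤ (⊸I {x = x} {M = M} Π) =
    subst (λ s → W Π r + 1 ≤ r ^ D Π * s) (sym (size-ƛ x M))
          (scaled-suc (m^n>0 r (D Π)) (weight≤ Π))
  weight≤ (⊸E {M = M} {N = N} _ Π Π′) =
    scaled-suc (m^n>0 r d) (scaled-+ (r ^ d) function≤ argument≤)
    where
      d : ℕ
      d = D Π ⊔ D Π′
      function≤ : W Π r ≤ r ^ d * size M
      function≤ = raise-degree (m≤m⊔n (D Π) (D Π′)) (weight≤ Π)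
      argument≤ : W Π′ r ≤ r ^ d * size N
      argument≤ = raise-degree (m≤n⊔m (D Π) (D Π′)) (weight≤ Π′)
  weight≤ (m {M = M} {x = x} xs _ _ Π) =
    subst (λ s → W Π r ≤ r ^ D Π * s) (sym (size-renameTo x (varList xs) M)) (weight≤ Π)
  weight≤ (st {M = M} _ _ _ Πs)  = begin
    r * maxF (λ i → W (Πs i) r) ≤⟨ *-monoʳ-≤ r (maxF-lub _ premise≤) ⟩
    r * (r ^ d * size M)        ≡⟨ sym (*-assoc r (r ^ d) (size M)) ⟩
    r ^ suc d * size M          ∎
    where
      open ≤-Reasoning
      d : ℕ
      d = maxF (λ i → D (Πs i))
      premise≤ : ∀ i → W (Πs i) r ≤ r ^ d * size M
      premise≤ i = raise-degree (maxF-ub (λ j → D (Πs j)) i) (weight≤ (Πs i))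
  weight≤ (∀I _ Π)               = weight≤ Π
  weight≤ (∀E _ _ Π)             = weight≤ Π
  weight≤ (conv _ _ Π)           = weight≤ Π

open WeightBound using (weight≤)

mainTheorem8 : ∀ {Γ M σ} (Π : Γ ⊢ M ∶ σ) →
    (rk Π ≤ size M)
    × (∀ (r : ℕ) → 0 < r → W Π r ≤ r ^ D Π * W Π 1)
    × (W Π 1 ≡ size M)
mainTheorem8 {M = M} Π = rank-bound , weight-bound , weight-one Π
  where
    rank-bound : rk Π ≤ size M
    rank-bound = ⊔-lub (size-positive M) (maxRank≤size Π)

    weight-bound : ∀ r → 0 < r → W Π r ≤ r ^ D Π * W Π 1
    weight-bound r 0<r = subst (λ s → W Π r ≤ r ^ D Π * s) (sym (weight-one Π))
                               (weight≤ r {{>-nonZero 0<r}} Π)
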